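{- Let $\mathbf C$ be a category with finite coproducts. The category of $\omega$-iteratable Elgot monads on $\mathbf C$ (with iteration-preserving monad morphisms) is isomorphic to the full subcategory of the category of Eilenberg–Moore algebras of the monad $(-)^\nu$ on $\omega$-iteratable monads consisting of those algebras $(\mathbb S,\rho\colon\mathbb S^\nu\to\mathbb S)$ satisfying the delay cancellation condition $\rho\circ\rhd=\rho$.
   Context: For a monad $\mathbb T$ on $\mathbf C$ (unit $\eta$, Kleisli lifting $(-)^*$), $T^\nu X=\nu\gamma.\,T(X+\gamma)$ denotes the final coalgebra of $\gamma\mapsto T(X+\gamma)$, with structure $\mathrm{out}$ (an isomorphism) and coiteration $\mathrm{coit}$ (the unique coalgebra morphism into it). When these exist for all $X$, $\mathbb T^\nu$ is a monad with unit $\eta^\nu=\mathrm{out}^{ -1}\circ\eta\circ\mathrm{inl}$ and Kleisli lifting $f^\ddagger$ of $f\colon X\to T^\nu Y$ determined by $\mathrm{out}\circ f^\ddagger=[\mathrm{out}\circ f,\eta\circ\mathrm{inr}\circ f^\ddagger]^*\circ\mathrm{out}$. A monad (or functor) $T$ is 1-iteratable if $T^\nu$ exists, $(n+1)$-iteratable if $T^\nu$ is $n$-iteratable, and $\omega$-iteratable if $n$-iteratable for all $n$. On the category of $\omega$-iteratable monads and monad morphisms, $\mathbb T\mapsto\mathbb T^\nu$ is a monad, acting on a monad morphism $\alpha$ by $\alpha^\nu=\mathrm{coit}(\alpha\circ\mathrm{out})$, with unit $\boldsymbol\eta_X=\mathrm{out}^{ -1}\circ T(\mathrm{inl})\colon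 TX\to T^\nu X$ and multiplication $\boldsymbol\mu_X=\mathrm{coit}(T[\mathrm{id},\mathrm{inr}\circ\mathrm{out}^{ -1}]\circ\mathrm{out}\circ\mathrm{out})\colon T^{\nu\nu}X\to T^\nu X$. An algebra is $(\mathbb S,\rho)$ with $\rho\colon\mathbb S^\nu\to\mathbb S$ a monad morphism, $\rho\circ\boldsymbol\eta=\mathrm{id}$ and $\rho\circ\boldsymbol\mu=\rho\circ\rho^\nu$; algebra morphisms are monad morphisms $\alpha$ with $\alpha\circ\rho=\rho'\circ\alpha^\nu$. The delay transformation is $\rhd=\mathrm{out}^{ -1}\circ\eta\circ\mathrm{inr}\colon S^\nu\to S^\nu$. An Elgot monad is a monad $\mathbb S$ with an operator assigning to every $f\colon X\to S(Y+X)$ a morphism $f^\dagger\colon X\to SY$ such that: fixpoint $f^\dagger=[\eta,f^\dagger]^*\circ f$; naturality $g^*\circ f^\dagger=([S(\mathrm{inl})\circ g,\eta\circ\mathrm{inr}]^*\circ f)^\dagger$ for $g\colon Y\to SZ$; codiagonal $(S[\mathrm{id},\mathrm{inr}]\circ f)^\dagger=(f^\dagger)^\dagger$ for $f\colon X\to S((Y+X)+X)$; uniformity: $f\circ h=S(\mathrm{id}+h)\circ g$ implies $f^\dagger\circ h=g^\dagger$ for $g\colon Z\to S(Y+Z)$, $h\colon Z\to X$. Morphisms of Elgot monads are monad morphisms $\alpha$ with $\alpha\circ f^\dagger=(\alpha\circ f)^\dagger$. -}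

module Defs where

open import Level using (Level; _⊔_) renaming (suc to lsuc)
open import Data.Nat using (ℕ; zero; suc)
open import Data.Unit.Polymorphic using (⊤)
open import Data.Product using (Σ; proj₁; proj₂; _×_)
open import Function.Bundles using (_⇔_)
open import Relation.Binary.Structures using (IsEquivalence)

record Category (o ℓ e : Level) : Set (lsuc (o ⊔ ℓ ⊔ e)) where
  infixr 9 _∘_
  infix  4 _≈_
  infix  4 _⇒_
  field
    Obj  : Set o
    _⇒_  : Obj → Obj → Set ℓ
    _≈_  : ∀ {A B} → A ⇒ B → A ⇒ B → Set e
    id   : ∀ {A} → A ⇒ A
    _∘_  : ∀ {A B C} → B ⇒ C → A ⇒ B → A ⇒ C
    equiv     : ∀ {A B} → IsEquivalence (_≈_ {A} {B})
    assoc     : ∀ {A B C D} {f : A ⇒ B} {g : B ⇒ C} {h : C ⇒ D} →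
                (h ∘ g) ∘ f ≈ h ∘ (g ∘ f)
    identityˡ : ∀ {A B} {f : A ⇒ B} → id ∘ f ≈ f
    identityʳ : ∀ {A B} {f : A ⇒ B} → f ∘ id ≈ f
    ∘-resp-≈  : ∀ {A B C} {f h : B ⇒ C} {g i : A ⇒ B} →
                f ≈ h → g ≈ i → f ∘ g ≈ h ∘ i

record Initial {o ℓ e} (C : Category o ℓ e) : Set (o ⊔ ℓ ⊔ e) where
  open Category C
  field
    ⊥        : Obj
    ¡        : ∀ {A} → ⊥ ⇒ A
    ¡-unique : ∀ {A} (f : ⊥ ⇒ A) → ¡ ≈ f

record Coproducts {o ℓ e} (C : Category o ℓ e) : Set (o ⊔ ℓ ⊔ e) where
  open Category C
  infixr 6 _+_
  field
    _+_     : Obj → Obj → Obj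
    inl     : ∀ {A B} → A ⇒ A + B
    inr     : ∀ {A B} → B ⇒ A + B
    [_,_]   : ∀ {A B X} → A ⇒ X → B ⇒ X → A + B ⇒ X
    inject₁ : ∀ {A B X} {f : A ⇒ X} {g : B ⇒ X} → [ f , g ] ∘ inl ≈ f
    inject₂ : ∀ {A B X} {f : A ⇒ X} {g : B ⇒ X} → [ f , g ] ∘ inr ≈ g
    unique  : ∀ {A B X} {f : A ⇒ X} {g : B ⇒ X} {h : A + B ⇒ X} →
              h ∘ inl ≈ f → h ∘ inr ≈ g → [ f , g ] ≈ h

module Theory {o ℓ e} (C : Category o ℓ e) (CP : Coproducts C) where
  open Category C
  open Coproducts CP

  infixr 6 _+₁_
  _+₁_ : ∀ {A B A' B'} → A ⇒ A' → B ⇒ B' → A + B ⇒ A' + B'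
  f +₁ g = [ inl ∘ f , inr ∘ g ]

  record PreMonad : Set (o ⊔ ℓ) where
    field
      T  : Obj → Obj
      η  : ∀ {X} → X ⇒ T X
      _* : ∀ {X Y} → X ⇒ T Y → T X ⇒ T Y
    fmap : ∀ {X Y} → X ⇒ Y → T X ⇒ T Y
    fmap f = (η ∘ f) *

  record IsMonad (S : PreMonad) : Set (o ⊔ ℓ ⊔ e) where
    open PreMonad S
    field
      *-resp-≈ : ∀ {X Y} {f g : X ⇒ T Y} → f ≈ g → f * ≈ g *
      η*       : ∀ {X} → η {X} * ≈ id
      *∘η      : ∀ {X Y} {f : X ⇒ T Y} → f * ∘ η ≈ f
      *-assoc  : ∀ {X Y Z} {f : X ⇒ T Y} {g : Y ⇒ T Z} →
                 (g * ∘ f) * ≈ g * ∘ f *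

  _⇛_ : PreMonad → PreMonad → Set (o ⊔ ℓ)
  S ⇛ S' = ∀ X → PreMonad.T S X ⇒ PreMonad.T S' X

  record IsMonadMorphism (S S' : PreMonad) (α : S ⇛ S') : Set (o ⊔ ℓ ⊔ e) where
    open PreMonad S
    open PreMonad S' renaming (T to T'; η to η'; _* to _*')
    field
      unit : ∀ {X} → α X ∘ η ≈ η'
      bind : ∀ {X Y} (f : X ⇒ T Y) → α Y ∘ f * ≈ (α Y ∘ f) *' ∘ α X

  record FinalCoalg (S : PreMonad) (X : Obj) : Set (o ⊔ ℓ ⊔ e) where
    open PreMonad S
    field
      Tν      : Obj
      out     : Tν ⇒ T (X + Tν)
      out⁻¹   : T (X + Tν) ⇒ Tν
      out-iso₁ : out⁻¹ ∘ out ≈ id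
      out-iso₂ : out ∘ out⁻¹ ≈ id
      coit    : ∀ {A} → A ⇒ T (X + A) → A ⇒ Tν
      coit-hom : ∀ {A} (c : A ⇒ T (X + A)) →
                 out ∘ coit c ≈ fmap (id +₁ coit c) ∘ c
      coit-unique : ∀ {A} (c : A ⇒ T (X + A)) (h : A ⇒ Tν) →
                 out ∘ h ≈ fmap (id +₁ h) ∘ c → h ≈ coit c

  Nu : PreMonad → Set (o ⊔ ℓ ⊔ e)
  Nu S = ∀ X → FinalCoalg S X

  -- The monad T^ν (unit and Kleisli lifting as in the paper; f‡ is the
  -- unique morphism with out ∘ f‡ = [out ∘ f , η ∘ inr ∘ f‡]* ∘ out,
  -- constructed by coiteration on T^ν X + T^ν Y).
  _ν⟨_⟩ : (S : PreMonad) → Nu S → PreMonad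
  S ν⟨ N ⟩ = record { T = λ X → FinalCoalg.Tν (N X) ; η = ην ; _* = lift }
    where
    open PreMonad S
    module N X = FinalCoalg (N X)
    ην : ∀ {X} → X ⇒ N.Tν X
    ην {X} = N.out⁻¹ X ∘ η ∘ inl
    lift : ∀ {X Y} → X ⇒ N.Tν Y → N.Tν X ⇒ N.Tν Y
    lift {X} {Y} f = N.coit Y c ∘ inl
      where
      c : N.Tν X + N.Tν Y ⇒ T (Y + (N.Tν X + N.Tν Y))
      c = [ [ fmap (id +₁ inr) ∘ N.out Y ∘ f , η ∘ inr ∘ inl ] * ∘ N.out X
          , fmap (id +₁ inr) ∘ N.out Y ]

  Iterable : ℕ → PreMonad → Set (o ⊔ ℓ ⊔ e)
  Iterable zero    S = ⊤
  Iterable (suc n) S = Σ (Nu S) (λ N → Iterable n (S ν⟨ N ⟩))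

  ωIterable : PreMonad → Set (o ⊔ ℓ ⊔ e)
  ωIterable S = ∀ n → Iterable n S

  -- chosen T^ν and T^νν (taken coherently from the 2-iteratability witness)
  ν₁ : ∀ {S} → ωIterable S → Nu S
  ν₁ w = proj₁ (w 2)

  ν₂ : ∀ {S} (w : ωIterable S) → Nu (S ν⟨ ν₁ w ⟩)
  ν₂ w = proj₁ (proj₂ (w 2))

  mapν : ∀ {S S'} (N : Nu S) (N' : Nu S') → S ⇛ S' → (S ν⟨ N ⟩) ⇛ (S' ν⟨ N' ⟩)
  mapν {S} N N' α X =
    FinalCoalg.coit (N' X) (α (X + FinalCoalg.Tν (N X)) ∘ FinalCoalg.out (N X))

  record ElgotStr (S : PreMonad) : Set (o ⊔ ℓ ⊔ e) where
    open PreMonad S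
    field
      _† : ∀ {X Y} → X ⇒ T (Y + X) → X ⇒ T Y
      †-resp-≈   : ∀ {X Y} {f g : X ⇒ T (Y + X)} → f ≈ g → f † ≈ g †
      fixpoint   : ∀ {X Y} (f : X ⇒ T (Y + X)) → f † ≈ [ η , f † ] * ∘ f
      naturality : ∀ {X Y Z} (f : X ⇒ T (Y + X)) (g : Y ⇒ T Z) →
                   g * ∘ f † ≈ ([ fmap inl ∘ g , η ∘ inr ] * ∘ f) †
      codiagonal : ∀ {X Y} (f : X ⇒ T ((Y + X) + X)) →
                   (fmap [ id , inr ] ∘ f) † ≈ (f †) †
      uniformity : ∀ {X Y Z} (f : X ⇒ T (Y + X)) (g : Z ⇒ T (Y + Z)) (h : Z ⇒ X) →
                   f ∘ h ≈ fmap (id +₁ h) ∘ g → f † ∘ h ≈ g †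

  _≃E_ : ∀ {S} → ElgotStr S → ElgotStr S → Set (o ⊔ ℓ ⊔ e)
  E ≃E E' = ∀ {X Y} (f : X ⇒ _) → ElgotStr._† E {X} {Y} f ≈ ElgotStr._† E' f

  PreservesIter : ∀ {S S'} → ElgotStr S → ElgotStr S' → S ⇛ S' → Set (o ⊔ ℓ ⊔ e)
  PreservesIter {S} {S'} E E' α =
    ∀ {X Y} (f : X ⇒ PreMonad.T S (Y + X)) →
      α Y ∘ ElgotStr._† E f ≈ ElgotStr._† E' (α (Y + X) ∘ f)

  module NuStructure (S : PreMonad) (w : ωIterable S) where
    open PreMonad S
    N₁ = ν₁ w
    N₂ = ν₂ w
    Sν  = S ν⟨ N₁ ⟩
    Sνν = Sν ν⟨ N₂ ⟩
    module N₁ X = FinalCoalg (N₁ X)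
    module N₂ X = FinalCoalg (N₂ X)

    boldη : S ⇛ Sν
    boldη X = N₁.out⁻¹ X ∘ fmap inl

    boldμ : Sνν ⇛ Sν
    boldμ X = N₁.coit X
      (fmap [ id , inr ∘ N₂.out⁻¹ X ] ∘ N₁.out (X + N₂.Tν X) ∘ N₂.out X)

    delay : Sν ⇛ Sν
    delay X = N₁.out⁻¹ X ∘ η ∘ inr

  record DCAlgebra (S : PreMonad) (w : ωIterable S) : Set (o ⊔ ℓ ⊔ e) where
    open NuStructure S w
    field
      ρ       : Sν ⇛ S
      ρ-mor   : IsMonadMorphism Sν S ρ
      ρ-unit  : ∀ X → ρ X ∘ boldη X ≈ id
      ρ-mult  : ∀ X → ρ X ∘ boldμ X ≈ ρ X ∘ mapν N₂ N₁ ρ X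
      ρ-delay : ∀ X → ρ X ∘ delay X ≈ ρ X

  _≃A_ : ∀ {S w} → DCAlgebra S w → DCAlgebra S w → Set (o ⊔ e)
  A ≃A A' = ∀ X → DCAlgebra.ρ A X ≈ DCAlgebra.ρ A' X

  IsAlgMorphism : ∀ {S S' w w'} → DCAlgebra S w → DCAlgebra S' w' → S ⇛ S' →
                  Set (o ⊔ e)
  IsAlgMorphism {w = w} {w' = w'} A A' α =
    ∀ X → α X ∘ DCAlgebra.ρ A X ≈ DCAlgebra.ρ A' X ∘ mapν (ν₁ w) (ν₁ w') α X

  record ElgotAlgIso : Set (lsuc (o ⊔ ℓ ⊔ e)) where
    field
      Φ : ∀ (S : PreMonad) → IsMonad S → (w : ωIterable S) →
          ElgotStr S → DCAlgebra S w
      Ψ : ∀ (S : PreMonad) → IsMonad S → (w : ωIterable S) →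
          DCAlgebra S w → ElgotStr S
      Φ-resp : ∀ S mS w {E E' : ElgotStr S} → E ≃E E' → Φ S mS w E ≃A Φ S mS w E'
      Ψ-resp : ∀ S mS w {A A' : DCAlgebra S w} → A ≃A A' → Ψ S mS w A ≃E Ψ S mS w A'
      ΨΦ : ∀ S mS w (E : ElgotStr S) → Ψ S mS w (Φ S mS w E) ≃E E
      ΦΨ : ∀ S mS w (A : DCAlgebra S w) → Φ S mS w (Ψ S mS w A) ≃A A
      hom : ∀ S S' (mS : IsMonad S) (mS' : IsMonad S')
              (w : ωIterable S) (w' : ωIterable S')
              (E : ElgotStr S) (E' : ElgotStr S') (α : S ⇛ S') →
              IsMonadMorphism S S' α →
              PreservesIter E E' α ⇔ IsAlgMorphism (Φ S mS w E) (Φ S' mS' w' E') α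

module Submission where

open import Function.Bundles using (mk⇔)
open import Relation.Binary.Bundles using (Setoid)
open import Relation.Binary.Structures using (IsEquivalence)
import Relation.Binary.Reasoning.Setoid as SetoidReasoning
open import Defs

-- An Elgot structure yields the algebra ρ = out† : T^ν → T, and an algebra yields the iteration
-- f† = ρ ∘ coit f.  These are mutually inverse because coit out = id and, by uniformity,
-- out† ∘ coit f = f†.  Under this correspondence the fixpoint law becomes ρ ∘ out⁻¹ = [ η , ρ ]*,
-- which for an algebra is exactly what delay cancellation provides; naturality corresponds to ρ
-- being a monad morphism, the codiagonal law to ρ ∘ μ = ρ ∘ ρ^ν, and uniformity to the fusion law
-- of coiteration.

module ElgotAlgebras {o ℓ e} (C : Category o ℓ e) (CP : Coproducts C) where
  open Category C
  open Coproducts CP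
  open Theory C CP

  hom-setoid : ∀ {A B} → Setoid ℓ e
  hom-setoid {A} {B} = record { Carrier = A ⇒ B ; _≈_ = _≈_ ; isEquivalence = equiv }

  module ≈ {A B} = IsEquivalence (equiv {A} {B})
  module HomReasoning {A B} = SetoidReasoning (hom-setoid {A} {B})
  open HomReasoning

  infixr 4 _⟩∘⟨_
  _⟩∘⟨_ : ∀ {A B D} {f h : B ⇒ D} {g i : A ⇒ B} → f ≈ h → g ≈ i → f ∘ g ≈ h ∘ i
  _⟩∘⟨_ = ∘-resp-≈

  refl⟩∘⟨_ : ∀ {A B D} {f : B ⇒ D} {g i : A ⇒ B} → g ≈ i → f ∘ g ≈ f ∘ i
  refl⟩∘⟨ q = ∘-resp-≈ ≈.refl q

  _⟩∘⟨refl : ∀ {A B D} {f h : B ⇒ D} {g : A ⇒ B} → f ≈ h → f ∘ g ≈ h ∘ g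
  p ⟩∘⟨refl = ∘-resp-≈ p ≈.refl

  sym-assoc : ∀ {A B D E} {f : A ⇒ B} {g : B ⇒ D} {h : D ⇒ E} → h ∘ (g ∘ f) ≈ (h ∘ g) ∘ f
  sym-assoc = ≈.sym assoc

  pullˡ : ∀ {A B D E} {a : D ⇒ E} {b : B ⇒ D} {c : B ⇒ E} {f : A ⇒ B} →
          a ∘ b ≈ c → a ∘ (b ∘ f) ≈ c ∘ f
  pullˡ p = ≈.trans sym-assoc (p ⟩∘⟨refl)

  cancelˡ : ∀ {A B D} {a : B ⇒ A} {b : A ⇒ B} {f : D ⇒ A} → a ∘ b ≈ id → a ∘ (b ∘ f) ≈ f
  cancelˡ p = ≈.trans (pullˡ p) identityˡ

  []-cong₂ : ∀ {A B X} {f f' : A ⇒ X} {g g' : B ⇒ X} → f ≈ f' → g ≈ g' → [ f , g ] ≈ [ f' , g' ]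
  []-cong₂ p q = ≈.sym (unique (≈.trans inject₁ p) (≈.trans inject₂ q))

  ∘[] : ∀ {A B X Y} {f : A ⇒ X} {g : B ⇒ X} {h : X ⇒ Y} → h ∘ [ f , g ] ≈ [ h ∘ f , h ∘ g ]
  ∘[] = ≈.sym (unique (≈.trans assoc (refl⟩∘⟨ inject₁)) (≈.trans assoc (refl⟩∘⟨ inject₂)))

  +-g-η : ∀ {A B X} {h : A + B ⇒ X} → [ h ∘ inl , h ∘ inr ] ≈ h
  +-g-η = unique ≈.refl ≈.refl

  +-η : ∀ {A B} → [ inl , inr ] ≈ id {A + B}
  +-η = unique identityˡ identityˡ

  []∘+₁ : ∀ {A B A' B' X} {f : A' ⇒ X} {g : B' ⇒ X} {h : A ⇒ A'} {k : B ⇒ B'} →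
          [ f , g ] ∘ (h +₁ k) ≈ [ f ∘ h , g ∘ k ]
  []∘+₁ = ≈.trans ∘[] ([]-cong₂ (pullˡ inject₁) (pullˡ inject₂))

  +₁∘+₁ : ∀ {A B A' B' A'' B''} {f : A' ⇒ A''} {g : B' ⇒ B''} {h : A ⇒ A'} {k : B ⇒ B'} →
          (f +₁ g) ∘ (h +₁ k) ≈ (f ∘ h) +₁ (g ∘ k)
  +₁∘+₁ = ≈.trans []∘+₁ ([]-cong₂ assoc assoc)

  +₁-cong₂ : ∀ {A B A' B'} {f f' : A ⇒ A'} {g g' : B ⇒ B'} → f ≈ f' → g ≈ g' → f +₁ g ≈ f' +₁ g'
  +₁-cong₂ p q = []-cong₂ (refl⟩∘⟨ p) (refl⟩∘⟨ q)

  +₁-id : ∀ {A B} → id {A} +₁ id {B} ≈ id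
  +₁-id = ≈.trans ([]-cong₂ identityʳ identityʳ) +-η

  module MonadLaws (S : PreMonad) (mS : IsMonad S) where
    open PreMonad S public
    open IsMonad mS public

    fmap-resp-≈ : ∀ {X Y} {f g : X ⇒ Y} → f ≈ g → fmap f ≈ fmap g
    fmap-resp-≈ p = *-resp-≈ (refl⟩∘⟨ p)

    fmap-id : ∀ {X} → fmap (id {X}) ≈ id
    fmap-id = ≈.trans (*-resp-≈ identityʳ) η*

    fmap-+₁-id : ∀ {A B} → fmap (id {A} +₁ id {B}) ≈ id
    fmap-+₁-id = ≈.trans (fmap-resp-≈ +₁-id) fmap-id

    *∘η∘ : ∀ {X Y Z} {f : Y ⇒ T Z} {g : X ⇒ Y} → f * ∘ η ∘ g ≈ f ∘ g
    *∘η∘ = pullˡ *∘η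

    fmap∘η∘ : ∀ {X Y Z} {f : Y ⇒ Z} {g : X ⇒ Y} → fmap f ∘ η ∘ g ≈ η ∘ f ∘ g
    fmap∘η∘ = ≈.trans *∘η∘ assoc

    *∘* : ∀ {X Y Z} {f : X ⇒ T Y} {g : Y ⇒ T Z} → g * ∘ f * ≈ (g * ∘ f) *
    *∘* = ≈.sym *-assoc

    *∘*∘ : ∀ {W X Y Z} {f : X ⇒ T Y} {g : Y ⇒ T Z} {h : W ⇒ T X} → g * ∘ f * ∘ h ≈ (g * ∘ f) * ∘ h
    *∘*∘ = pullˡ *∘*

    *∘fmap : ∀ {X Y Z} {f : X ⇒ Y} {g : Y ⇒ T Z} → g * ∘ fmap f ≈ (g ∘ f) *
    *∘fmap = ≈.trans *∘* (*-resp-≈ *∘η∘)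

    *∘fmap∘ : ∀ {W X Y Z} {f : X ⇒ Y} {g : Y ⇒ T Z} {h : W ⇒ T X} → g * ∘ fmap f ∘ h ≈ (g ∘ f) * ∘ h
    *∘fmap∘ = pullˡ *∘fmap

    fmap∘fmap∘ : ∀ {W X Y Z} {f : X ⇒ Y} {g : Y ⇒ Z} {h : W ⇒ T X} → fmap g ∘ fmap f ∘ h ≈ fmap (g ∘ f) ∘ h
    fmap∘fmap∘ = pullˡ (≈.trans *∘fmap (*-resp-≈ assoc))

    *∘[]*∘ : ∀ {A B Y Z W} {g : Y ⇒ T Z} {a : A ⇒ T Y} {b : B ⇒ T Y} {h : W ⇒ T (A + B)} →
             g * ∘ [ a , b ] * ∘ h ≈ [ g * ∘ a , g * ∘ b ] * ∘ h
    *∘[]*∘ = ≈.trans *∘*∘ (*-resp-≈ ∘[] ⟩∘⟨refl)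

  module ElgotLaws (S : PreMonad) (mS : IsMonad S) (E : ElgotStr S) where
    open MonadLaws S mS
    open ElgotStr E

    fmap∘† : ∀ {X Y Z} {f : X ⇒ T (Y + X)} {g : Y ⇒ Z} → fmap g ∘ f † ≈ (fmap (g +₁ id) ∘ f) †
    fmap∘† {f = f} {g} = ≈.trans (naturality f (η ∘ g))
      (†-resp-≈ (*-resp-≈ (≈.trans ([]-cong₂ fmap∘η∘ (refl⟩∘⟨ ≈.sym identityʳ)) (≈.sym ∘[])) ⟩∘⟨refl))

    -- The loop  c  first iterates v and, on exit with x, continues with the loop k from f x.
    -- The codiagonal law splits c into an inner loop running v and an outer one running k.
    module Sequencing {A B X Y} (k : B ⇒ T (Y + B)) (v : A ⇒ T (X + A)) (f : X ⇒ B) where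
      c : A + B ⇒ T (Y + (A + B))
      c = [ [ fmap (id +₁ inr) ∘ k ∘ f , η ∘ inr ∘ inl ] * ∘ v , fmap (id +₁ inr) ∘ k ]

      F : A + B ⇒ T ((Y + (A + B)) + (A + B))
      F = [ [ fmap (inl +₁ inr) ∘ k ∘ f , η ∘ inl ∘ inr ∘ inl ] * ∘ v , fmap (inl +₁ inr) ∘ k ]

      c≈flatten-F : c ≈ fmap [ id , inr ] ∘ F
      c≈flatten-F = ≈.sym (begin
        fmap [ id , inr ] ∘ F
          ≈⟨ ≈.trans ∘[] ([]-cong₂ *∘[]*∘ flatten) ⟩
        [ [ fmap [ id , inr ] ∘ fmap (inl +₁ inr) ∘ k ∘ f , fmap [ id , inr ] ∘ η ∘ inl ∘ inr ∘ inl ] * ∘ v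
        , fmap (id +₁ inr) ∘ k ]
          ≈⟨ []-cong₂ (*-resp-≈ ([]-cong₂ flatten
                 (≈.trans fmap∘η∘ (refl⟩∘⟨ ≈.trans (pullˡ inject₁) identityˡ))) ⟩∘⟨refl) ≈.refl ⟩
        c ∎)
        where
        flatten : ∀ {W} {h : W ⇒ T (Y + B)} → fmap [ id , inr ] ∘ fmap (inl +₁ inr) ∘ h ≈ fmap (id +₁ inr) ∘ h
        flatten = ≈.trans fmap∘fmap∘
          (fmap-resp-≈ (≈.trans []∘+₁ ([]-cong₂ (≈.trans identityˡ (≈.sym identityʳ)) ≈.refl)) ⟩∘⟨refl)

      F†∘inr : F † ∘ inr ≈ fmap inl ∘ k †
      F†∘inr = begin
        F † ∘ inr                ≈⟨ uniformity F (fmap (inl +₁ id) ∘ k) inr (≈.trans inject₂ reassociate) ⟩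
        (fmap (inl +₁ id) ∘ k) † ≈⟨ ≈.sym fmap∘† ⟩
        fmap inl ∘ k †           ∎
        where
        reassociate : fmap (inl +₁ inr) ∘ k ≈ fmap (id +₁ inr) ∘ fmap (inl +₁ id) ∘ k
        reassociate = ≈.trans
          (fmap-resp-≈ (≈.trans (+₁-cong₂ (≈.sym identityˡ) (≈.sym identityʳ)) (≈.sym +₁∘+₁)) ⟩∘⟨refl)
          (≈.sym fmap∘fmap∘)

      inl-after-† : [ η ∘ inl , fmap inl ∘ k † ] * ∘ k ≈ fmap (inl {B = A + B}) ∘ k †
      inl-after-† = begin
        [ η ∘ inl , fmap inl ∘ k † ] * ∘ k ≈⟨ ≈.sym (*-resp-≈ (≈.trans ∘[] ([]-cong₂ *∘η ≈.refl)) ⟩∘⟨refl) ⟩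
        (fmap inl ∘ [ η , k † ]) * ∘ k     ≈⟨ ≈.sym *∘*∘ ⟩
        fmap inl ∘ [ η , k † ] * ∘ k       ≈⟨ refl⟩∘⟨ ≈.sym (fixpoint k) ⟩
        fmap inl ∘ k †                     ∎

      G : A ⇒ T (Y + A)
      G = [ fmap inl ∘ k † ∘ f , η ∘ inr ] * ∘ v

      F†∘inl : F † ∘ inl ≈ fmap (id +₁ inl) ∘ G
      F†∘inl = begin
        F † ∘ inl
          ≈⟨ ≈.trans (fixpoint F ⟩∘⟨refl) (≈.trans assoc (refl⟩∘⟨ inject₁)) ⟩
        [ η , F † ] * ∘ [ fmap (inl +₁ inr) ∘ k ∘ f , η ∘ inl ∘ inr ∘ inl ] * ∘ v
          ≈⟨ *∘[]*∘ ⟩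
        [ [ η , F † ] * ∘ fmap (inl +₁ inr) ∘ k ∘ f , [ η , F † ] * ∘ η ∘ inl ∘ inr ∘ inl ] * ∘ v
          ≈⟨ *-resp-≈ ([]-cong₂ (≈.trans *∘fmap∘ (*-resp-≈ []∘+₁ ⟩∘⟨refl))
                                (≈.trans *∘η∘ (pullˡ inject₁))) ⟩∘⟨refl ⟩
        [ [ η ∘ inl , F † ∘ inr ] * ∘ k ∘ f , η ∘ inr ∘ inl ] * ∘ v
          ≈⟨ *-resp-≈ ([]-cong₂ (≈.trans (*-resp-≈ ([]-cong₂ ≈.refl F†∘inr) ⟩∘⟨refl)
                                  (≈.trans sym-assoc (≈.trans (inl-after-† ⟩∘⟨refl) assoc))) ≈.refl) ⟩∘⟨refl ⟩
        [ fmap inl ∘ k † ∘ f , η ∘ inr ∘ inl ] * ∘ v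
          ≈⟨ ≈.sym (≈.trans *∘*∘ (*-resp-≈ (≈.trans ∘[]
               ([]-cong₂ (≈.trans fmap∘fmap∘ (fmap-resp-≈ (≈.trans inject₁ identityʳ) ⟩∘⟨refl))
                         (≈.trans fmap∘η∘ (refl⟩∘⟨ inject₂)))) ⟩∘⟨refl)) ⟩
        fmap (id +₁ inl) ∘ G ∎

      †-seq : c † ∘ inl ≈ (k † ∘ f) * ∘ v †
      †-seq = begin
        c † ∘ inl                       ≈⟨ †-resp-≈ c≈flatten-F ⟩∘⟨refl ⟩
        (fmap [ id , inr ] ∘ F) † ∘ inl ≈⟨ codiagonal F ⟩∘⟨refl ⟩
        (F †) † ∘ inl                   ≈⟨ uniformity (F †) G inl F†∘inl ⟩
        G †                             ≈⟨ ≈.sym (naturality v (k † ∘ f)) ⟩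
        (k † ∘ f) * ∘ v †               ∎

  module FinalCoalgebraLaws (S : PreMonad) (mS : IsMonad S) (N : Nu S) where
    open MonadLaws S mS
    module N X = FinalCoalg (N X)

    Sν : PreMonad
    Sν = S ν⟨ N ⟩

    infix 20 _‡
    _‡ : ∀ {X Y} → X ⇒ N.Tν Y → N.Tν X ⇒ N.Tν Y
    _‡ = PreMonad._* Sν

    ην : ∀ {X} → X ⇒ N.Tν X
    ην = PreMonad.η Sν

    fmapν : ∀ {X Y} → X ⇒ Y → N.Tν X ⇒ N.Tν Y
    fmapν = PreMonad.fmap Sν

    ▷ : ∀ X → N.Tν X ⇒ N.Tν X
    ▷ X = N.out⁻¹ X ∘ η ∘ inr

    coit-resp-≈ : ∀ {X A} {c c' : A ⇒ T (X + A)} → c ≈ c' → N.coit X c ≈ N.coit X c'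
    coit-resp-≈ {X} {c = c} {c'} p = N.coit-unique X c' (N.coit X c) (≈.trans (N.coit-hom X c) (refl⟩∘⟨ p))

    coit-fusion : ∀ {X A B} (c : A ⇒ T (X + A)) (d : B ⇒ T (X + B)) (h : B ⇒ A) →
                  c ∘ h ≈ fmap (id +₁ h) ∘ d → N.coit X c ∘ h ≈ N.coit X d
    coit-fusion {X} c d h p = N.coit-unique X d (N.coit X c ∘ h) (begin
      N.out X ∘ N.coit X c ∘ h                      ≈⟨ pullˡ (N.coit-hom X c) ⟩
      (fmap (id +₁ N.coit X c) ∘ c) ∘ h             ≈⟨ assoc ⟩
      fmap (id +₁ N.coit X c) ∘ c ∘ h               ≈⟨ refl⟩∘⟨ p ⟩
      fmap (id +₁ N.coit X c) ∘ fmap (id +₁ h) ∘ d  ≈⟨ fmap∘fmap∘ ⟩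
      fmap ((id +₁ N.coit X c) ∘ (id +₁ h)) ∘ d     ≈⟨ fmap-resp-≈ (≈.trans +₁∘+₁ (+₁-cong₂ identityˡ ≈.refl)) ⟩∘⟨refl ⟩
      fmap (id +₁ N.coit X c ∘ h) ∘ d               ∎)

    coit-out : ∀ X → N.coit X (N.out X) ≈ id
    coit-out X = ≈.sym (N.coit-unique X (N.out X) id
      (≈.trans identityʳ (≈.sym (≈.trans (fmap-+₁-id ⟩∘⟨refl) identityˡ))))

    out∘ην : ∀ {X} → N.out X ∘ ην ≈ η ∘ inl
    out∘ην {X} = cancelˡ (N.out-iso₂ X)

    out∘‡ : ∀ {X Y} (f : X ⇒ N.Tν Y) → N.out Y ∘ f ‡ ≈ [ N.out Y ∘ f , η ∘ inr ∘ f ‡ ] * ∘ N.out X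
    out∘‡ {X} {Y} f = begin
      N.out Y ∘ cc ∘ inl
        ≈⟨ ≈.trans (pullˡ (N.coit-hom Y c)) (≈.trans assoc (refl⟩∘⟨ inject₁)) ⟩
      fmap (id +₁ cc) ∘ [ fmap (id +₁ inr) ∘ N.out Y ∘ f , η ∘ inr ∘ inl ] * ∘ N.out X
        ≈⟨ *∘[]*∘ ⟩
      [ fmap (id +₁ cc) ∘ fmap (id +₁ inr) ∘ N.out Y ∘ f , fmap (id +₁ cc) ∘ η ∘ inr ∘ inl ] * ∘ N.out X
        ≈⟨ *-resp-≈ ([]-cong₂ unchanged (≈.trans fmap∘η∘ (refl⟩∘⟨ ≈.trans (pullˡ inject₂) assoc))) ⟩∘⟨refl ⟩
      [ N.out Y ∘ f , η ∘ inr ∘ cc ∘ inl ] * ∘ N.out X ∎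
      where
      c : N.Tν X + N.Tν Y ⇒ T (Y + (N.Tν X + N.Tν Y))
      c = [ [ fmap (id +₁ inr) ∘ N.out Y ∘ f , η ∘ inr ∘ inl ] * ∘ N.out X
          , fmap (id +₁ inr) ∘ N.out Y ]
      cc = N.coit Y c
      cc∘inr : cc ∘ inr ≈ id
      cc∘inr = ≈.trans (coit-fusion c (N.out Y) inr inject₂) (coit-out Y)
      unchanged : fmap (id +₁ cc) ∘ fmap (id +₁ inr) ∘ N.out Y ∘ f ≈ N.out Y ∘ f
      unchanged = ≈.trans fmap∘fmap∘
        (≈.trans (fmap-resp-≈ (≈.trans +₁∘+₁ (+₁-cong₂ identityˡ cc∘inr)) ⟩∘⟨refl)
                 (≈.trans (fmap-+₁-id ⟩∘⟨refl) identityˡ))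

    out∘fmapν : ∀ {A B} (h : A ⇒ B) → N.out B ∘ fmapν h ≈ fmap (h +₁ fmapν h) ∘ N.out A
    out∘fmapν h = ≈.trans (out∘‡ (ην ∘ h)) (*-resp-≈ (≈.trans ([]-cong₂
      (≈.trans sym-assoc (≈.trans (out∘ην ⟩∘⟨refl) assoc)) ≈.refl) (≈.sym ∘[])) ⟩∘⟨refl)

    [ην,▷]‡∘boldη≈out⁻¹ : ∀ X → [ ην , ▷ X ] ‡ ∘ N.out⁻¹ (X + N.Tν X) ∘ fmap inl ≈ N.out⁻¹ X
    [ην,▷]‡∘boldη≈out⁻¹ X = begin
      L                         ≈⟨ ≈.sym (≈.trans (N.out-iso₁ X ⟩∘⟨refl) identityˡ) ⟩
      (N.out⁻¹ X ∘ N.out X) ∘ L ≈⟨ ≈.trans assoc (refl⟩∘⟨ out∘L) ⟩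
      N.out⁻¹ X ∘ id            ≈⟨ identityʳ ⟩
      N.out⁻¹ X                 ∎
      where
      g : X + N.Tν X ⇒ N.Tν X
      g = [ ην , ▷ X ]
      L = g ‡ ∘ N.out⁻¹ (X + N.Tν X) ∘ fmap inl
      out∘g : N.out X ∘ g ≈ η
      out∘g = ≈.trans ∘[] (≈.trans ([]-cong₂ out∘ην (cancelˡ (N.out-iso₂ X))) +-g-η)
      out∘L : N.out X ∘ L ≈ id
      out∘L = begin
        N.out X ∘ L
          ≈⟨ ≈.trans (pullˡ (out∘‡ g)) assoc ⟩
        [ N.out X ∘ g , η ∘ inr ∘ g ‡ ] * ∘ N.out (X + N.Tν X) ∘ N.out⁻¹ (X + N.Tν X) ∘ fmap inl
          ≈⟨ ≈.trans (refl⟩∘⟨ cancelˡ (N.out-iso₂ _)) *∘fmap ⟩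
        ([ N.out X ∘ g , η ∘ inr ∘ g ‡ ] ∘ inl) * ≈⟨ *-resp-≈ (≈.trans inject₁ out∘g) ⟩
        η *                                       ≈⟨ η* ⟩
        id                                        ∎

  module FromElgot (S : PreMonad) (mS : IsMonad S) (w : ωIterable S) (E : ElgotStr S) where
    open MonadLaws S mS
    open ElgotStr E
    open ElgotLaws S mS E
    open NuStructure S w using (N₁; N₂; boldη; boldμ; delay)
    open FinalCoalgebraLaws S mS N₁ using (Sν)

    out†∘coit≈† : ∀ {X A} (c : A ⇒ T (X + A)) → N₁.out X † ∘ N₁.coit X c ≈ c †
    out†∘coit≈† {X} c = uniformity (N₁.out X) c (N₁.coit X c) (N₁.coit-hom X c)

    ρ : Sν ⇛ S
    ρ X = N₁.out X †

    ρ∘out⁻¹∘ : ∀ {X W} {h : W ⇒ T (X + N₁.Tν X)} → ρ X ∘ N₁.out⁻¹ X ∘ h ≈ [ η , ρ X ] * ∘ h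
    ρ∘out⁻¹∘ {X} = pullˡ (≈.trans (fixpoint (N₁.out X) ⟩∘⟨refl)
                          (≈.trans assoc (≈.trans (refl⟩∘⟨ N₁.out-iso₂ X) identityʳ)))

    ρ-unit : ∀ X → ρ X ∘ boldη X ≈ id
    ρ-unit X = ≈.trans ρ∘out⁻¹∘ (≈.trans *∘fmap (≈.trans (*-resp-≈ inject₁) η*))

    ρ-delay : ∀ X → ρ X ∘ delay X ≈ ρ X
    ρ-delay X = ≈.trans ρ∘out⁻¹∘ (≈.trans *∘η∘ inject₂)

    ρ-mor : IsMonadMorphism Sν S ρ
    ρ-mor = record
      { unit = ≈.trans ρ∘out⁻¹∘ (≈.trans *∘η∘ inject₁)
      ; bind = λ {X} {Y} f →
          ≈.trans (pullˡ (out†∘coit≈† _)) (Sequencing.†-seq (N₁.out Y) (N₁.out X) f)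
      }

    ρ-mult : ∀ X → ρ X ∘ boldμ X ≈ ρ X ∘ mapν N₂ N₁ ρ X
    ρ-mult X = begin
      ρ X ∘ boldμ X                            ≈⟨ out†∘coit≈† m ⟩
      m †                                      ≈⟨ ≈.sym (uniformity f m out₂ f∘out₂) ⟩
      f † ∘ out₂                               ≈⟨ †-resp-≈ f≈flatten-F ⟩∘⟨refl ⟩
      (fmap [ id , inr ] ∘ F) † ∘ out₂         ≈⟨ codiagonal F ⟩∘⟨refl ⟩
      (F †) † ∘ out₂                           ≈⟨ ≈.sym (†-resp-≈ fmap∘†) ⟩∘⟨refl ⟩
      (fmap (id +₁ out₂) ∘ ρ (X + W)) † ∘ out₂ ≈⟨ uniformity _ _ out₂ assoc ⟩
      (ρ (X + W) ∘ out₂) †                     ≈⟨ ≈.sym (out†∘coit≈† _) ⟩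
      ρ X ∘ mapν N₂ N₁ ρ X                     ∎
      where
      W = N₂.Tν X
      out₂ = N₂.out X
      out₁ = N₁.out (X + W)
      m = fmap [ id , inr ∘ N₂.out⁻¹ X ] ∘ out₁ ∘ out₂
      f = fmap [ id +₁ out₂ , inr ] ∘ out₁
      F = fmap ((id +₁ out₂) +₁ id) ∘ out₁
      f∘out₂ : f ∘ out₂ ≈ fmap (id +₁ out₂) ∘ m
      f∘out₂ = ≈.trans assoc (≈.sym (≈.trans fmap∘fmap∘ (fmap-resp-≈ (≈.trans ∘[] ([]-cong₂ identityʳ
                 (≈.trans (pullˡ inject₂) (≈.trans assoc (≈.trans (refl⟩∘⟨ N₂.out-iso₂ X) identityʳ))))) ⟩∘⟨refl)))
      f≈flatten-F : f ≈ fmap [ id , inr ] ∘ F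
      f≈flatten-F = ≈.sym (≈.trans fmap∘fmap∘ (fmap-resp-≈ (≈.trans []∘+₁ ([]-cong₂ identityˡ identityʳ)) ⟩∘⟨refl))

    toAlgebra : DCAlgebra S w
    toAlgebra = record { ρ = ρ ; ρ-mor = ρ-mor ; ρ-unit = ρ-unit ; ρ-mult = ρ-mult ; ρ-delay = ρ-delay }

  module FromAlgebra (S : PreMonad) (mS : IsMonad S) (w : ωIterable S) (A : DCAlgebra S w) where
    open MonadLaws S mS
    open NuStructure S w using (N₁; N₂; boldη; boldμ)
    open FinalCoalgebraLaws S mS N₁
      using (_‡; ην; ▷; fmapν; coit-resp-≈; coit-fusion; out∘‡; out∘fmapν; [ην,▷]‡∘boldη≈out⁻¹)
    open DCAlgebra A
    open IsMonadMorphism ρ-mor renaming (unit to ρ∘ην; bind to ρ∘‡)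

    infix 20 _†
    _† : ∀ {X Y} → X ⇒ T (Y + X) → X ⇒ T Y
    _† {X} {Y} f = ρ Y ∘ N₁.coit Y f

    -- Writing out⁻¹ as [ ην , ▷ ]‡ ∘ boldη, the monad-morphism and unit laws reduce ρ ∘ out⁻¹
    -- to [ ρ ∘ ην , ρ ∘ ▷ ]*; delay cancellation makes the second component ρ.
    ρ∘out⁻¹ : ∀ X → ρ X ∘ N₁.out⁻¹ X ≈ [ η , ρ X ] *
    ρ∘out⁻¹ X = begin
      ρ X ∘ N₁.out⁻¹ X                                  ≈⟨ refl⟩∘⟨ ≈.sym ([ην,▷]‡∘boldη≈out⁻¹ X) ⟩
      ρ X ∘ g ‡ ∘ boldη (X + N₁.Tν X)                   ≈⟨ pullˡ (ρ∘‡ g) ⟩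
      ((ρ X ∘ g) * ∘ ρ (X + N₁.Tν X)) ∘ boldη (X + N₁.Tν X) ≈⟨ ≈.trans assoc (refl⟩∘⟨ ρ-unit _) ⟩
      (ρ X ∘ g) * ∘ id                                  ≈⟨ identityʳ ⟩
      (ρ X ∘ g) *                                       ≈⟨ *-resp-≈ (≈.trans ∘[] ([]-cong₂ ρ∘ην (ρ-delay X))) ⟩
      [ η , ρ X ] *                                     ∎
      where
      g = [ ην , ▷ X ]

    fixpoint : ∀ {X Y} (f : X ⇒ T (Y + X)) → f † ≈ [ η , f † ] * ∘ f
    fixpoint {X} {Y} f = begin
      ρ Y ∘ N₁.coit Y f                      ≈⟨ refl⟩∘⟨ ≈.sym (≈.trans (N₁.out-iso₁ Y ⟩∘⟨refl) identityˡ) ⟩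
      ρ Y ∘ (N₁.out⁻¹ Y ∘ N₁.out Y) ∘ N₁.coit Y f ≈⟨ ≈.trans (refl⟩∘⟨ assoc) (pullˡ (ρ∘out⁻¹ Y)) ⟩
      [ η , ρ Y ] * ∘ N₁.out Y ∘ N₁.coit Y f ≈⟨ refl⟩∘⟨ N₁.coit-hom Y f ⟩
      [ η , ρ Y ] * ∘ fmap (id +₁ N₁.coit Y f) ∘ f ≈⟨ *∘fmap∘ ⟩
      ([ η , ρ Y ] ∘ (id +₁ N₁.coit Y f)) * ∘ f    ≈⟨ *-resp-≈ (≈.trans []∘+₁ ([]-cong₂ identityʳ ≈.refl)) ⟩∘⟨refl ⟩
      [ η , f † ] * ∘ f                      ∎

    naturality : ∀ {X Y Z} (f : X ⇒ T (Y + X)) (g : Y ⇒ T Z) →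
                 g * ∘ f † ≈ ([ fmap inl ∘ g , η ∘ inr ] * ∘ f) †
    naturality {X} {Y} {Z} f g = begin
      g * ∘ ρ Y ∘ N₁.coit Y f       ≈⟨ *-resp-≈ g≈ρ∘h ⟩∘⟨refl ⟩
      (ρ Z ∘ h) * ∘ ρ Y ∘ N₁.coit Y f ≈⟨ ≈.trans sym-assoc (≈.sym (ρ∘‡ h) ⟩∘⟨refl) ⟩
      (ρ Z ∘ h ‡) ∘ N₁.coit Y f     ≈⟨ ≈.trans assoc (refl⟩∘⟨ h‡∘coit) ⟩
      ρ Z ∘ N₁.coit Z f'            ∎
      where
      h = boldη Z ∘ g
      f' = [ fmap inl ∘ g , η ∘ inr ] * ∘ f
      g≈ρ∘h : g ≈ ρ Z ∘ h
      g≈ρ∘h = ≈.sym (≈.trans (pullˡ (ρ-unit Z)) identityˡ)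
      out∘h : N₁.out Z ∘ h ≈ fmap inl ∘ g
      out∘h = ≈.trans (refl⟩∘⟨ assoc) (cancelˡ (N₁.out-iso₂ Z))
      h‡∘coit : h ‡ ∘ N₁.coit Y f ≈ N₁.coit Z f'
      h‡∘coit = N₁.coit-unique Z f' (h ‡ ∘ N₁.coit Y f) (begin
        N₁.out Z ∘ h ‡ ∘ N₁.coit Y f
          ≈⟨ ≈.trans (pullˡ (out∘‡ h)) (≈.trans assoc (refl⟩∘⟨ N₁.coit-hom Y f)) ⟩
        [ N₁.out Z ∘ h , η ∘ inr ∘ h ‡ ] * ∘ fmap (id +₁ N₁.coit Y f) ∘ f
          ≈⟨ *∘fmap∘ ⟩
        ([ N₁.out Z ∘ h , η ∘ inr ∘ h ‡ ] ∘ (id +₁ N₁.coit Y f)) * ∘ f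
          ≈⟨ *-resp-≈ (≈.trans []∘+₁
               ([]-cong₂ (≈.trans identityʳ out∘h) (≈.trans assoc (refl⟩∘⟨ assoc)))) ⟩∘⟨refl ⟩
        [ fmap inl ∘ g , η ∘ inr ∘ h ‡ ∘ N₁.coit Y f ] * ∘ f
          ≈⟨ ≈.sym (≈.trans *∘*∘ (*-resp-≈ (≈.trans ∘[] ([]-cong₂
               (≈.trans fmap∘fmap∘ (fmap-resp-≈ (≈.trans inject₁ identityʳ) ⟩∘⟨refl))
               (≈.trans fmap∘η∘ (refl⟩∘⟨ inject₂)))) ⟩∘⟨refl)) ⟩
        fmap (id +₁ h ‡ ∘ N₁.coit Y f) ∘ f' ∎)

    ρ-natural : ∀ {A B} (h : A ⇒ B) → ρ B ∘ fmapν h ≈ fmap h ∘ ρ A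
    ρ-natural h = ≈.trans (ρ∘‡ (ην ∘ h)) (*-resp-≈ (pullˡ ρ∘ην) ⟩∘⟨refl)

    -- K unfolds f twice: first into T^ν (Y + X), then into T^νν Y.
    module Codiagonal {X Y} (f : X ⇒ T ((Y + X) + X)) where
      W : Obj
      W = N₂.Tν Y

      cf : X ⇒ N₁.Tν (Y + X)
      cf = N₁.coit (Y + X) f

      K : X ⇒ W
      K = N₂.coit Y cf

      out₂ : W ⇒ N₁.Tν (Y + W)
      out₂ = N₂.out Y

      q : N₁.Tν (Y + X) ⇒ N₁.Tν (Y + W)
      q = fmapν (id +₁ K)

      out₂∘K : out₂ ∘ K ≈ q ∘ cf
      out₂∘K = N₂.coit-hom Y cf

      ρν∘K : mapν N₂ N₁ ρ Y ∘ K ≈ N₁.coit Y (ρ (Y + X) ∘ cf)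
      ρν∘K = coit-fusion (ρ (Y + W) ∘ out₂) (ρ (Y + X) ∘ cf) K
        (≈.trans assoc (≈.trans (refl⟩∘⟨ out₂∘K)
          (≈.trans sym-assoc (≈.trans (ρ-natural (id +₁ K) ⟩∘⟨refl) assoc))))

      μ-step : [ id , inr ∘ N₂.out⁻¹ Y ] ∘ ((id +₁ K) +₁ q) ∘ (id +₁ cf) ≈ (id +₁ K) ∘ [ id , inr {A = Y} ]
      μ-step = begin
        [ id , inr ∘ N₂.out⁻¹ Y ] ∘ ((id +₁ K) +₁ q) ∘ (id +₁ cf) ≈⟨ ≈.trans (refl⟩∘⟨ +₁∘+₁) []∘+₁ ⟩
        [ id ∘ (id +₁ K) ∘ id , (inr ∘ N₂.out⁻¹ Y) ∘ q ∘ cf ]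
          ≈⟨ []-cong₂ (≈.trans identityˡ identityʳ)
               (≈.trans assoc (refl⟩∘⟨ ≈.trans (refl⟩∘⟨ ≈.sym out₂∘K) (≈.trans (pullˡ (N₂.out-iso₁ Y)) identityˡ))) ⟩
        [ id +₁ K , inr ∘ K ]                                      ≈⟨ ≈.sym (≈.trans ∘[] ([]-cong₂ identityʳ inject₂)) ⟩
        (id +₁ K) ∘ [ id , inr ]                                   ∎

      m : W ⇒ T (Y + W)
      m = fmap [ id , inr ∘ N₂.out⁻¹ Y ] ∘ N₁.out (Y + W) ∘ out₂

      m∘K : m ∘ K ≈ fmap (id +₁ K) ∘ fmap [ id , inr ] ∘ f
      m∘K = begin
        m ∘ K
          ≈⟨ ≈.trans assoc (refl⟩∘⟨ ≈.trans assoc (refl⟩∘⟨ out₂∘K)) ⟩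
        fmap [ id , inr ∘ N₂.out⁻¹ Y ] ∘ N₁.out (Y + W) ∘ q ∘ cf
          ≈⟨ refl⟩∘⟨ ≈.trans (pullˡ (out∘fmapν (id +₁ K))) (≈.trans assoc (refl⟩∘⟨ N₁.coit-hom (Y + X) f)) ⟩
        fmap [ id , inr ∘ N₂.out⁻¹ Y ] ∘ fmap ((id +₁ K) +₁ q) ∘ fmap (id +₁ cf) ∘ f
          ≈⟨ ≈.trans (refl⟩∘⟨ fmap∘fmap∘) fmap∘fmap∘ ⟩
        fmap ([ id , inr ∘ N₂.out⁻¹ Y ] ∘ ((id +₁ K) +₁ q) ∘ (id +₁ cf)) ∘ f
          ≈⟨ fmap-resp-≈ μ-step ⟩∘⟨refl ⟩
        fmap ((id +₁ K) ∘ [ id , inr ]) ∘ f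
          ≈⟨ ≈.sym fmap∘fmap∘ ⟩
        fmap (id +₁ K) ∘ fmap [ id , inr ] ∘ f ∎

      μ∘K : boldμ Y ∘ K ≈ N₁.coit Y (fmap [ id , inr ] ∘ f)
      μ∘K = coit-fusion m (fmap [ id , inr ] ∘ f) K m∘K

      codiagonal : (fmap [ id , inr ] ∘ f) † ≈ (f †) †
      codiagonal = begin
        ρ Y ∘ N₁.coit Y (fmap [ id , inr ] ∘ f) ≈⟨ refl⟩∘⟨ ≈.sym μ∘K ⟩
        ρ Y ∘ boldμ Y ∘ K                       ≈⟨ ≈.trans (pullˡ (ρ-mult Y)) assoc ⟩
        ρ Y ∘ mapν N₂ N₁ ρ Y ∘ K                ≈⟨ refl⟩∘⟨ ρν∘K ⟩
        ρ Y ∘ N₁.coit Y (ρ (Y + X) ∘ cf)        ∎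

    toElgot : ElgotStr S
    toElgot = record
      { _† = _†
      ; †-resp-≈ = λ p → refl⟩∘⟨ coit-resp-≈ p
      ; fixpoint = fixpoint
      ; naturality = naturality
      ; codiagonal = Codiagonal.codiagonal
      ; uniformity = λ f g h p → ≈.trans assoc (refl⟩∘⟨ coit-fusion f g h p)
      }

  module Morphisms (S S' : PreMonad) (mS : IsMonad S) (mS' : IsMonad S')
                   (w : ωIterable S) (w' : ωIterable S')
                   (E : ElgotStr S) (E' : ElgotStr S') (α : S ⇛ S')
                   (α-mor : IsMonadMorphism S S' α) where
    module MS = MonadLaws S mS
    module MS' = MonadLaws S' mS'
    module N X = FinalCoalg (ν₁ w X)
    module N' X = FinalCoalg (ν₁ w' X)
    open FinalCoalgebraLaws S' mS' (ν₁ w') using (coit-fusion)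
    open FromElgot S mS w E using (out†∘coit≈†)
    open FromElgot S' mS' w' E' using () renaming (out†∘coit≈† to out†'∘coit≈†')
    open IsMonadMorphism α-mor
    open ElgotStr E using (_†)
    open ElgotStr E' using () renaming (_† to _†')

    α-natural : ∀ {A B} (h : A ⇒ B) → α B ∘ MS.fmap h ≈ MS'.fmap h ∘ α A
    α-natural h = ≈.trans (bind (MS.η ∘ h)) (MS'.*-resp-≈ (pullˡ unit) ⟩∘⟨refl)

    αν∘coit : ∀ {X Y} (f : X ⇒ MS.T (Y + X)) → mapν (ν₁ w) (ν₁ w') α Y ∘ N.coit Y f ≈ N'.coit Y (α (Y + X) ∘ f)
    αν∘coit {X} {Y} f = coit-fusion _ _ (N.coit Y f)
      (≈.trans assoc (≈.trans (refl⟩∘⟨ N.coit-hom Y f) (≈.trans (pullˡ (α-natural _)) assoc)))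

    preserves⇒algebra-morphism : PreservesIter E E' α →
                                 IsAlgMorphism (FromElgot.toAlgebra S mS w E) (FromElgot.toAlgebra S' mS' w' E') α
    preserves⇒algebra-morphism pres X = ≈.trans (pres (N.out X)) (≈.sym (out†'∘coit≈†' _))

    algebra-morphism⇒preserves : IsAlgMorphism (FromElgot.toAlgebra S mS w E) (FromElgot.toAlgebra S' mS' w' E') α →
                                 PreservesIter E E' α
    algebra-morphism⇒preserves hom {X} {Y} f = begin
      α Y ∘ f †                                          ≈⟨ refl⟩∘⟨ ≈.sym (out†∘coit≈† f) ⟩
      α Y ∘ N.out Y † ∘ N.coit Y f                       ≈⟨ pullˡ (hom Y) ⟩
      (N'.out Y †' ∘ mapν (ν₁ w) (ν₁ w') α Y) ∘ N.coit Y f ≈⟨ ≈.trans assoc (refl⟩∘⟨ αν∘coit f) ⟩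
      N'.out Y †' ∘ N'.coit Y (α (Y + X) ∘ f)            ≈⟨ out†'∘coit≈†' _ ⟩
      (α (Y + X) ∘ f) †'                                 ∎

  elgotAlgIso : ElgotAlgIso
  elgotAlgIso = record
    { Φ = FromElgot.toAlgebra
    ; Ψ = FromAlgebra.toElgot
    ; Φ-resp = λ S mS w E≃E' X → E≃E' (FinalCoalg.out (ν₁ w X))
    ; Ψ-resp = λ S mS w A≃A' {X} {Y} f → A≃A' Y ⟩∘⟨refl
    ; ΨΦ = λ S mS w E f → FromElgot.out†∘coit≈† S mS w E f
    ; ΦΨ = λ S mS w A X → ≈.trans (refl⟩∘⟨ FinalCoalgebraLaws.coit-out S mS (ν₁ w) X) identityʳ
    ; hom = λ S S' mS mS' w w' E E' α α-mor → mk⇔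
        (Morphisms.preserves⇒algebra-morphism S S' mS mS' w w' E E' α α-mor)
        (Morphisms.algebra-morphism⇒preserves S S' mS mS' w w' E E' α α-mor)
    }

theorem5p15 : ∀ {o ℓ e} (C : Category o ℓ e) (I : Initial C) (CP : Coproducts C) →
    Theory.ElgotAlgIso C CP
theorem5p15 C _ CP = ElgotAlgebras.elgotAlgIso C CP
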